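{- Let $S$ be a numerical semigroup. Its complement $\widetilde{S}$ is a numerical semigroup if and only if $S$ has at most one small atom.
   Context: $\mathbb{N}=\{0,1,2,\dots\}$. A numerical set is a subset $S\subseteq\mathbb{N}$ with $0\in S$ and $\mathbb{N}\setminus S$ finite. Its gaps are the elements of $\mathbb{N}\setminus S$, and $F(S)$ is the largest gap, with $F(\mathbb{N})=-1$. A numerical semigroup is a numerical set closed under addition. An atom of a numerical semigroup $S$ is a positive element not expressible as a sum of two positive elements of $S$. A small atom is an atom smaller than $F(S)$. For $S\neq\mathbb{N}$, the base is $B(S)=\max\{s\in S\mid s<F(S)\}$. Young diagram of $S$: it has one left-justified row for each gap $\ell$. The top row corresponds to $F(S)$, and the gaps decrease going down. The row for $\ell$ has length $|\{s\in S\mid s<\ell\}|$. This is a bijection between numerical sets and Young diagrams, with $\mathbb{N}$ corresponding to the empty diagram. The complement of a Young diagram with rows $\lambda_1\ge\dots\ge\lambda_g$ has rows $\lambda_1-\lambda_g\ge\dots\ge\lambda_1-\lambda_1$, zero rows being discarded. Geometrically, this is the rest of the $g\times\lambda_1$ rectangle rotated by $180^\circ$. The complement $\widetilde{S}$ is the numerical set whose Young diagram is the complement of that of $S$. One has $\widetilde{\mathbb{N}}=\mathbb{N}$, and for $S\neq\mathbb{N}$ equivalently $\widetilde{S}=\{B(S)-s\mid s\in S,\ s\le B(S)\}\cup\{n\mid n\ge B(S)\}$. -}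

module Defs where

open import Data.Nat using (ℕ; zero; suc; _+_; _∸_; _≤_; _<_; _≤ᵇ_)
open import Data.Nat.Properties using (≤⇒≤ᵇ)
open import Data.Bool using (Bool; T; true; false; if_then_else_; _∧_; _∨_)
open import Data.Bool.Properties using (∨-zeroˡ)
open import Data.Maybe using (Maybe; just; nothing)
open import Data.Integer as ℤ using (ℤ)
open import Data.Product using (_×_; ∃-syntax)
open import Relation.Nullary using (¬_)
open import Relation.Binary.PropositionalEquality using (_≡_; refl; trans; cong)

record NumericalSet : Set where
  field
    mem      : ℕ → Bool
    zero∈    : mem 0 ≡ true
    bound    : ℕ
    cofinite : ∀ n → bound ≤ n → mem n ≡ true
open NumericalSet public

_∈ₛ_ : ℕ → NumericalSet → Set
n ∈ₛ S = mem S n ≡ true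

lastFalse : (ℕ → Bool) → ℕ → Maybe ℕ
lastFalse f zero    = nothing
lastFalse f (suc k) = if f k then lastFalse f k else just k

lastTrue : (ℕ → Bool) → ℕ → ℕ
lastTrue f zero    = 0
lastTrue f (suc k) = if f k then k else lastTrue f k

lastTrue-true : (f : ℕ → Bool) → f 0 ≡ true → ∀ m → f (lastTrue f m) ≡ true
lastTrue-true f f0 zero = f0
lastTrue-true f f0 (suc k) with f k in eq
... | true  = eq
... | false = lastTrue-true f f0 k

-- Frobenius number F(S): the largest gap, or -1 if S = ℕ
frobenius : NumericalSet → ℤ
frobenius S with lastFalse (mem S) (bound S)
... | nothing = ℤ.-[1+ 0 ]
... | just F  = ℤ.+ F

-- Base B(S) = max{ s ∈ S | s < F(S) } (only meaningful when S ≠ ℕ; 0 otherwise)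
base : NumericalSet → ℕ
base S with lastFalse (mem S) (bound S)
... | nothing = 0
... | just F  = lastTrue (mem S) F

base∈ : (S : NumericalSet) → mem S (base S) ≡ true
base∈ S with lastFalse (mem S) (bound S)
... | nothing = zero∈ S
... | just F  = lastTrue-true (mem S) (zero∈ S) F

-- Membership in the complement S̃:
--   S̃ = ℕ if S = ℕ, and otherwise
--   S̃ = { B(S) - s | s ∈ S, s ≤ B(S) } ∪ { n | n ≥ B(S) }.
compAux : Maybe ℕ → (ℕ → Bool) → ℕ → ℕ → Bool
compAux nothing  f B n = true
compAux (just _) f B n = (B ≤ᵇ n) ∨ ((n ≤ᵇ B) ∧ f (B ∸ n))

complementMem : NumericalSet → ℕ → Bool
complementMem S n = compAux (lastFalse (mem S) (bound S)) (mem S) (base S) n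

compAux-zero : ∀ m f B → f B ≡ true → compAux m f B 0 ≡ true
compAux-zero nothing f B p = refl
compAux-zero (just _) f B p with B ≤ᵇ 0
... | true  = refl
... | false rewrite p = refl

T-∨ : ∀ b c → T b → (b ∨ c) ≡ true
T-∨ true c _ = refl

compAux-cof : ∀ m f B n → B ≤ n → compAux m f B n ≡ true
compAux-cof nothing  f B n le = refl
compAux-cof (just _) f B n le = T-∨ (B ≤ᵇ n) _ (≤⇒≤ᵇ le)

complement-zero : (S : NumericalSet) → complementMem S 0 ≡ true
complement-zero S = compAux-zero (lastFalse (mem S) (bound S)) (mem S) (base S) (base∈ S)

complement-cofinite : (S : NumericalSet) → ∀ n → base S ≤ n → complementMem S n ≡ true
complement-cofinite S n le = compAux-cof (lastFalse (mem S) (bound S)) (mem S) (base S) n le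

complement : NumericalSet → NumericalSet
complement S = record
  { mem      = complementMem S
  ; zero∈    = complement-zero S
  ; bound    = base S
  ; cofinite = complement-cofinite S
  }

IsNumericalSemigroup : NumericalSet → Set
IsNumericalSemigroup S = ∀ a b → a ∈ₛ S → b ∈ₛ S → (a + b) ∈ₛ S

IsAtom : NumericalSet → ℕ → Set
IsAtom S a = 0 < a × a ∈ₛ S ×
  ¬ (∃[ x ] ∃[ y ] (0 < x × 0 < y × x ∈ₛ S × y ∈ₛ S × x + y ≡ a))

IsSmallAtom : NumericalSet → ℕ → Set
IsSmallAtom S a = IsAtom S a × (ℤ.+ a ℤ.< frobenius S)

AtMostOneSmallAtom : NumericalSet → Set
AtMostOneSmallAtom S = ∀ a b → IsSmallAtom S a → IsSmallAtom S b → a ≡ b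

-- For S ≠ ℕ with base B, the complement is S̃ = { n ≥ B } ∪ { B − s ∣ s ∈ S, s ≤ B },
-- and the small atoms of S are exactly its atoms ≤ B, since B is the largest
-- element of S below F(S).
--
-- If S̃ is closed under addition, let c be the largest element of S below B
-- and d = B − c.  Nothing in S lies strictly between 0 and d (its sum with c
-- would beat c), and subtracting d from an element x ∈ S with d < x ≤ B
-- stays inside S: with e = x − d, both c − e = B − x and d = B − c lie in
-- S̃, so does their sum B − e, hence e ∈ S.  Thus d ∈ S and every atom ≤ B
-- equals d.
--
-- Conversely, if a is the only atom ≤ B, every element of S up to B is a
-- sum of atoms ≤ B, hence a multiple of a, and every multiple of a lies in
-- S.  For u, v ∈ S̃ with u + v < B, the numbers B, B − u and B − v are
-- multiples of a, hence so is B − (u + v), which therefore lies in S.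
module Submission where

open import Defs
open import Data.Bool using (Bool; true; false; T; _∨_; _∧_)
import Data.Bool.Properties as Bool
open import Data.Empty using (⊥-elim)
open import Data.Integer as ℤ using ()
open import Data.Maybe using (just; nothing)
open import Data.Nat using (ℕ; zero; suc; _+_; _*_; _∸_; _≤_; _<_; _≤ᵇ_; z≤n; s≤s; _≤?_; _<?_)
open import Data.Nat.Divisibility using (_∣_; divides-refl; ∣-refl; _∣0; ∣m∣n⇒∣m+n; ∣m+n∣m⇒∣n)
open import Data.Nat.Induction using (<-wellFounded)
open import Data.Nat.Properties
open import Data.Product using (_×_; _,_; ∃-syntax)
open import Data.Sum using (_⊎_; inj₁; inj₂)
open import Data.Unit using (tt)
open import Function.Bundles using (_⇔_; mk⇔; Equivalence)
open import Function.Properties.Equivalence using () renaming (sym to ⇔-sym; trans to ⇔-trans)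
open import Induction.WellFounded using (Acc; acc)
open import Relation.Nullary using (¬_; Dec; yes; no; contradiction)
open import Relation.Nullary.Decidable using (map′; _×-dec_)
open import Relation.Binary.PropositionalEquality

_∈ᵇ_ : ℕ → (ℕ → Bool) → Set
n ∈ᵇ f = f n ≡ true

AdditivelyClosed : (ℕ → Set) → Set
AdditivelyClosed P = ∀ a b → P a → P b → P (a + b)

AtMostOne : (ℕ → Set) → Set
AtMostOne P = ∀ a b → P a → P b → a ≡ b

AdditivelyClosed-resp-⇔ : ∀ {P Q : ℕ → Set} → (∀ n → P n ⇔ Q n) →
                          AdditivelyClosed P ⇔ AdditivelyClosed Q
AdditivelyClosed-resp-⇔ P⇔Q = mk⇔
  (λ closed a b qa qb → to (P⇔Q _) (closed a b (from (P⇔Q a) qa) (from (P⇔Q b) qb)))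
  (λ closed a b pa pb → from (P⇔Q _) (closed a b (to (P⇔Q a) pa) (to (P⇔Q b) pb)))
  where open Equivalence

AtMostOne-resp-⇔ : ∀ {P Q : ℕ → Set} → (∀ n → P n ⇔ Q n) → AtMostOne P ⇔ AtMostOne Q
AtMostOne-resp-⇔ P⇔Q = mk⇔
  (λ unique a b qa qb → unique a b (from (P⇔Q a) qa) (from (P⇔Q b) qb))
  (λ unique a b pa pb → unique a b (to (P⇔Q a) pa) (to (P⇔Q b) pb))
  where open Equivalence

lastTrue-≤ : ∀ f m → lastTrue f m ≤ m
lastTrue-≤ f zero = z≤n
lastTrue-≤ f (suc m) with f m
... | true  = n≤1+n m
... | false = m≤n⇒m≤1+n (lastTrue-≤ f m)

lastTrue-< : ∀ f m → lastTrue f (suc m) < suc m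
lastTrue-< f m with f m
... | true  = ≤-refl
... | false = s≤s (lastTrue-≤ f m)

lastTrue-maximal : ∀ f {k} m → k ∈ᵇ f → k < m → k ≤ lastTrue f m
lastTrue-maximal f (suc m) k∈f (s≤s k≤m) with f m in fm
... | true = k≤m
... | false with m≤n⇒m<n∨m≡n k≤m
...   | inj₁ k<m  = lastTrue-maximal f m k∈f k<m
...   | inj₂ refl = contradiction (trans (sym k∈f) fm) λ ()

≤lastTrue⇒< : ∀ f {a} m → 0 < a → a ≤ lastTrue f m → a < m
≤lastTrue⇒< f zero    0<a a≤0 = contradiction (≤-trans 0<a a≤0) λ ()
≤lastTrue⇒< f (suc m) 0<a a≤c = ≤-<-trans a≤c (lastTrue-< f m)

IsSumOfPositives : (ℕ → Bool) → ℕ → Set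
IsSumOfPositives f a = ∃[ x ] ∃[ y ] (0 < x × 0 < y × x ∈ᵇ f × y ∈ᵇ f × x + y ≡ a)

Atom : (ℕ → Bool) → ℕ → Set
Atom f a = 0 < a × a ∈ᵇ f × ¬ IsSumOfPositives f a

atom∈ : ∀ {f a} → Atom f a → a ∈ᵇ f
atom∈ (_ , a∈f , _) = a∈f

AtomBelow : ℕ → (ℕ → Bool) → ℕ → Set
AtomBelow B f a = Atom f a × a ≤ B

isSumOfPositives? : ∀ f a → Dec (IsSumOfPositives f a)
isSumOfPositives? f a = map′ to from (anyUpTo? summand? a)
  where
  Summand : ℕ → Set
  Summand x = 0 < x × 0 < a ∸ x × x ∈ᵇ f × (a ∸ x) ∈ᵇ f

  summand? : ∀ x → Dec (Summand x)
  summand? x = (0 <? x) ×-dec (0 <? a ∸ x) ×-dec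
               (f x Bool.≟ true) ×-dec (f (a ∸ x) Bool.≟ true)

  to : ∃[ x ] (x < a × Summand x) → IsSumOfPositives f a
  to (x , x<a , 0<x , 0<y , x∈f , y∈f) = x , a ∸ x , 0<x , 0<y , x∈f , y∈f , m+[n∸m]≡n (<⇒≤ x<a)

  from : IsSumOfPositives f a → ∃[ x ] (x < a × Summand x)
  from (x , y , 0<x , 0<y , x∈f , y∈f , x+y≡a) =
    x , subst (x <_) x+y≡a (m<m+n x 0<y) ,
    0<x , subst (0 <_) y≡a∸x 0<y , x∈f , subst (_∈ᵇ f) y≡a∸x y∈f
    where
    y≡a∸x : y ≡ a ∸ x
    y≡a∸x = trans (sym (m+n∸m≡n x y)) (cong (_∸ x) x+y≡a)

atom-or-sum : ∀ f {a} → 0 < a → a ∈ᵇ f → Atom f a ⊎ IsSumOfPositives f a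
atom-or-sum f {a} 0<a a∈f with isSumOfPositives? f a
... | yes sum = inj₂ sum
... | no ¬sum = inj₁ (0<a , a∈f , ¬sum)

atom-≤ : ∀ {f x} → x ∈ᵇ f → 0 < x → ∃[ a ] (Atom f a × a ≤ x)
atom-≤ {f} = go (<-wellFounded _)
  where
  go : ∀ {x} → Acc _<_ x → x ∈ᵇ f → 0 < x → ∃[ a ] (Atom f a × a ≤ x)
  go {x} (acc rec) x∈f 0<x with atom-or-sum f 0<x x∈f
  ... | inj₁ atom = x , atom , ≤-refl
  ... | inj₂ (y , z , 0<y , 0<z , y∈f , _ , refl) with go (rec (m<m+n y 0<z)) y∈f 0<y
  ...   | a , atom , a≤y = a , atom , ≤-trans a≤y (m≤m+n y z)

multiple∈ : ∀ {f} → 0 ∈ᵇ f → AdditivelyClosed (_∈ᵇ f) → ∀ {a x} → a ∈ᵇ f → a ∣ x → x ∈ᵇ f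
multiple∈ {f} 0∈f additive {a} a∈f (divides-refl q) = go q
  where
  go : ∀ q → (q * a) ∈ᵇ f
  go zero    = 0∈f
  go (suc q) = additive a (q * a) a∈f (go q)

unique-atom-divides : ∀ {f B a} → AtMostOne (AtomBelow B f) → AtomBelow B f a →
                      ∀ {x} → x ∈ᵇ f → x ≤ B → a ∣ x
unique-atom-divides {f} {B} {a} unique a-atom = go (<-wellFounded _)
  where
  go : ∀ {x} → Acc _<_ x → x ∈ᵇ f → x ≤ B → a ∣ x
  go {zero}  _         _   _   = a ∣0
  go {suc x} (acc rec) x∈f x≤B with atom-or-sum f (s≤s z≤n) x∈f
  ... | inj₁ x-atom = subst (a ∣_) (unique a (suc x) a-atom (x-atom , x≤B)) ∣-refl
  ... | inj₂ (y , z , 0<y , 0<z , y∈f , z∈f , y+z≡x) =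
    subst (a ∣_) y+z≡x (∣m∣n⇒∣m+n (go (rec y<x) y∈f (<⇒≤ (<-≤-trans y<x x≤B)))
                                   (go (rec z<x) z∈f (<⇒≤ (<-≤-trans z<x x≤B))))
    where
    y<x : y < suc x
    y<x = subst (y <_) y+z≡x (m<m+n y 0<z)
    z<x : z < suc x
    z<x = subst (z <_) y+z≡x (m<n+m z 0<y)

Mirror : ℕ → (ℕ → Bool) → ℕ → Set
Mirror B f n = B ≤ n ⊎ ∃[ s ] (s ∈ᵇ f × n + s ≡ B)

compAux-just⇔mirror : ∀ {F} B f n → compAux (just F) f B n ≡ true ⇔ Mirror B f n
compAux-just⇔mirror B f n = mk⇔ to from
  where
  to : (B ≤ᵇ n) ∨ ((n ≤ᵇ B) ∧ f (B ∸ n)) ≡ true → Mirror B f n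
  to h with B ≤ᵇ n in B≤ᵇn
  ... | true = inj₁ (≤ᵇ⇒≤ B n (subst T (sym B≤ᵇn) tt))
  ... | false with n ≤ᵇ B in n≤ᵇB
  ...   | true  = inj₂ (B ∸ n , h , m+[n∸m]≡n (≤ᵇ⇒≤ n B (subst T (sym n≤ᵇB) tt)))
  ...   | false = contradiction h λ ()

  from : Mirror B f n → (B ≤ᵇ n) ∨ ((n ≤ᵇ B) ∧ f (B ∸ n)) ≡ true
  from (inj₁ B≤n) = T-∨ (B ≤ᵇ n) _ (≤⇒≤ᵇ B≤n)
  from (inj₂ (s , s∈f , refl)) with n + s ≤ᵇ n
  ... | true  = refl
  ... | false with n ≤ᵇ n + s | ≤⇒≤ᵇ (m≤m+n n s)
  ...   | true | _ rewrite m+n∸m≡n n s = s∈f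

mirror-reflect : ∀ {B f n s} → Mirror B f n → n + s ≡ B → 0 < s → s ∈ᵇ f
mirror-reflect {n = n} (inj₁ B≤n) refl 0<s = contradiction B≤n (<⇒≱ (m<m+n n 0<s))
mirror-reflect {f = f} {n} (inj₂ (s′ , s′∈f , n+s′≡B)) n+s≡B _ =
  subst (_∈ᵇ f) (+-cancelˡ-≡ n _ _ (trans n+s′≡B (sym n+s≡B))) s′∈f

mirror-below : ∀ {B f n} → Mirror B f n → n < B → ∃[ s ] (s ∈ᵇ f × n + s ≡ B)
mirror-below (inj₁ B≤n)  n<B = contradiction B≤n (<⇒≱ n<B)
mirror-below (inj₂ below) _   = below

unique-atom⇒mirror-closed : ∀ {f} → 0 ∈ᵇ f → AdditivelyClosed (_∈ᵇ f) → ∀ {B} → B ∈ᵇ f →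
                             AtMostOne (AtomBelow B f) → AdditivelyClosed (Mirror B f)
unique-atom⇒mirror-closed {f} 0∈f additive {B} B∈f unique u v u∈ v∈ with B ≤? u + v
... | yes B≤u+v = inj₁ B≤u+v
... | no  B≰u+v with atom-≤ B∈f (≤-<-trans z≤n (≰⇒> B≰u+v))
...   | a , a-atom , a≤B =
  inj₂ (B ∸ (u + v) , multiple∈ 0∈f additive (atom∈ a-atom) a∣r ,
        m+[n∸m]≡n (<⇒≤ u+v<B))
  where
  u+v<B = ≰⇒> B≰u+v

  a∣elem : ∀ {x} → x ∈ᵇ f → x ≤ B → a ∣ x
  a∣elem = unique-atom-divides unique (a-atom , a≤B)

  a∣B : a ∣ B
  a∣B = a∣elem B∈f ≤-refl

  a∣mirror : ∀ {n} → Mirror B f n → n < B → a ∣ n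
  a∣mirror {n} n∈ n<B with mirror-below n∈ n<B
  ... | s , s∈f , n+s≡B =
    ∣m+n∣m⇒∣n (subst (a ∣_) (sym (trans (+-comm s n) n+s≡B)) a∣B)
              (a∣elem s∈f (subst (s ≤_) n+s≡B (m≤n+m s n)))

  a∣r : a ∣ B ∸ (u + v)
  a∣r = ∣m+n∣m⇒∣n (subst (a ∣_) (sym (m+[n∸m]≡n (<⇒≤ u+v<B))) a∣B)
                  (∣m∣n⇒∣m+n (a∣mirror u∈ (≤-<-trans (m≤m+n u v) u+v<B))
                             (a∣mirror v∈ (≤-<-trans (m≤n+m v u) u+v<B)))

module _ {f : ℕ → Bool} (additive : AdditivelyClosed (_∈ᵇ f))
         {B : ℕ} (closed : AdditivelyClosed (Mirror B f))
         {c d : ℕ} (c∈f : c ∈ᵇ f) (c-maximal : ∀ {x} → x ∈ᵇ f → x < B → x ≤ c)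
         (c+d≡B : c + d ≡ B) (0<d : 0 < d) where

  ≤step⇒≡step : ∀ {x} → x ∈ᵇ f → 0 < x → x ≤ d → x ≡ d
  ≤step⇒≡step {x} x∈f 0<x x≤d with x <? d
  ... | no  x≮d = ≤-antisym x≤d (≮⇒≥ x≮d)
  ... | yes x<d =
    contradiction (c-maximal (additive x c x∈f c∈f) x+c<B) (<⇒≱ (m<n+m c 0<x))
    where
    x+c<B : x + c < B
    x+c<B = subst (x + c <_) (trans (+-comm d c) c+d≡B) (+-monoˡ-< c x<d)

  ∸step∈ : ∀ {x} → d < x → x ∈ᵇ f → x ≤ B → (x ∸ d) ∈ᵇ f
  ∸step∈ {x} d<x x∈f x≤B = mirror-reflect (closed g d g∈ d∈) g+d+e≡B (m<n⇒0<n∸m d<x)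
    where
    e = x ∸ d
    d+e≡x : d + e ≡ x
    d+e≡x = m+[n∸m]≡n (<⇒≤ d<x)
    e≤c : e ≤ c
    e≤c = +-cancelˡ-≤ d e c (subst₂ _≤_ (sym d+e≡x) (trans (sym c+d≡B) (+-comm c d)) x≤B)
    g = c ∸ e
    g+e≡c : g + e ≡ c
    g+e≡c = m∸n+n≡m e≤c
    g+x≡B : g + x ≡ B
    g+x≡B = begin
      g + x       ≡⟨ cong (g +_) (trans (sym d+e≡x) (+-comm d e)) ⟩
      g + (e + d) ≡⟨ +-assoc g e d ⟨
      g + e + d   ≡⟨ cong (_+ d) g+e≡c ⟩
      c + d       ≡⟨ c+d≡B ⟩
      B           ∎
      where open ≡-Reasoning
    g∈ : Mirror B f g
    g∈ = inj₂ (x , x∈f , g+x≡B)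
    d∈ : Mirror B f d
    d∈ = inj₂ (c , c∈f , trans (+-comm d c) c+d≡B)
    g+d+e≡B : g + d + e ≡ B
    g+d+e≡B = trans (+-assoc g d e) (trans (cong (g +_) d+e≡x) g+x≡B)

  step∈ : ∀ {x} → x ∈ᵇ f → 0 < x → x ≤ B → d ∈ᵇ f
  step∈ = go (<-wellFounded _)
    where
    go : ∀ {x} → Acc _<_ x → x ∈ᵇ f → 0 < x → x ≤ B → d ∈ᵇ f
    go {x} (acc rec) x∈f 0<x x≤B with x ≤? d
    ... | yes x≤d = subst (_∈ᵇ f) (≤step⇒≡step x∈f 0<x x≤d) x∈f
    ... | no  x≰d = go (rec (∸-monoʳ-< 0<d (<⇒≤ d<x))) (∸step∈ d<x x∈f x≤B)
                       (m<n⇒0<n∸m d<x) (≤-trans (m∸n≤m x d) x≤B)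
      where d<x = ≰⇒> x≰d

  atom≡step : ∀ {a} → AtomBelow B f a → a ≡ d
  atom≡step {a} ((0<a , a∈f , ¬sum) , a≤B) with a ≤? d
  ... | yes a≤d = ≤step⇒≡step a∈f 0<a a≤d
  ... | no  a≰d = contradiction (d , a ∸ d , 0<d , m<n⇒0<n∸m d<a ,
                                step∈ a∈f 0<a a≤B , ∸step∈ d<a a∈f a≤B ,
                                m+[n∸m]≡n (<⇒≤ d<a)) ¬sum
    where d<a = ≰⇒> a≰d

mirror-closed⇒unique-atom : ∀ {f} → 0 ∈ᵇ f → AdditivelyClosed (_∈ᵇ f) →
                            ∀ B → AdditivelyClosed (Mirror B f) → AtMostOne (AtomBelow B f)
mirror-closed⇒unique-atom _ _ zero _ _ _ ((0<a , _) , a≤0) _ =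
  contradiction (≤-trans 0<a a≤0) λ ()
mirror-closed⇒unique-atom {f} 0∈f additive B@(suc k) closed a b a-atom b-atom =
  trans (atom≡B∸c a-atom) (sym (atom≡B∸c b-atom))
  where
  c = lastTrue f B
  c<B = lastTrue-< f k
  atom≡B∸c : ∀ {a} → AtomBelow B f a → a ≡ B ∸ c
  atom≡B∸c = atom≡step additive closed (lastTrue-true f 0∈f B) (lastTrue-maximal f B)
                       (m+[n∸m]≡n (<⇒≤ c<B)) (m<n⇒0<n∸m c<B)

mirror-closed⇔unique-atom : ∀ {f} → 0 ∈ᵇ f → AdditivelyClosed (_∈ᵇ f) → ∀ {B} → B ∈ᵇ f →
                            AdditivelyClosed (Mirror B f) ⇔ AtMostOne (AtomBelow B f)
mirror-closed⇔unique-atom 0∈f additive {B} B∈f =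
  mk⇔ (mirror-closed⇒unique-atom 0∈f additive B) (unique-atom⇒mirror-closed 0∈f additive B∈f)

module _ (S : NumericalSet) where

  private
    largestGap = lastFalse (mem S) (bound S)

  largestlargestGap-cases : largestGap ≡ nothing ⊎ ∃[ F ] (largestGap ≡ just F)
  largestlargestGap-cases with largestGap
  ... | nothing = inj₁ refl
  ... | just F  = inj₂ (F , refl)

  complement-ℕ : largestGap ≡ nothing → ∀ n → n ∈ₛ complement S
  complement-ℕ eq n rewrite eq = refl

  no-small-atom : largestGap ≡ nothing → ∀ a → ¬ IsSmallAtom S a
  no-small-atom eq a (_ , a<F) rewrite eq with a<F
  ... | ()

  module _ {F : ℕ} (eq : largestGap ≡ just F) where

    small-atom⇔atom-below : ∀ a → IsSmallAtom S a ⇔ AtomBelow (base S) (mem S) a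
    small-atom⇔atom-below a rewrite eq = mk⇔
      (λ { (atom , ℤ.+<+ a<F) → atom , lastTrue-maximal (mem S) F (atom∈ atom) a<F })
      (λ { (atom@(0<a , _) , a≤B) → atom , ℤ.+<+ (≤lastTrue⇒< (mem S) F 0<a a≤B) })

    complement⇔mirror : ∀ n → n ∈ₛ complement S ⇔ Mirror (base S) (mem S) n
    complement⇔mirror n rewrite eq = compAux-just⇔mirror {F} _ (mem S) n

corollary4p2 : (S : NumericalSet) → IsNumericalSemigroup S →
    (IsNumericalSemigroup (complement S) ⇔ AtMostOneSmallAtom S)
corollary4p2 S semigroup with largestlargestGap-cases S
... | inj₁ eq       =
  mk⇔ (λ _ a _ small-a _ → ⊥-elim (no-small-atom S eq a small-a))
      (λ _ u v _ _ → complement-ℕ S eq (u + v))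
... | inj₂ (F , eq) =
  ⇔-trans (AdditivelyClosed-resp-⇔ (complement⇔mirror S eq))
  (⇔-trans (mirror-closed⇔unique-atom (zero∈ S) semigroup (base∈ S))
           (⇔-sym (AtMostOne-resp-⇔ (small-atom⇔atom-below S eq))))
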